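{- Let $a,b,c,d,e,f,g$ be positive integers with $d^2=a^2+b^2$, $e^2=a^2+c^2$, $f^2=b^2+c^2$ and $g^2=a^2+b^2+c^2$, and suppose $a=pq$ with $p,q$ primes. Then neither of the ordered pairs $(d-b,\,d+b)$ and $(e-c,\,e+c)$ equals $(1,\,p^2q^2)$. -}

module Defs where

-- If d − b = 1 then a² = d² − b² = 2b + 1. The space diagonal satisfies g² = a² + f², and
-- f > b because c > 0, so f² < g² = f² + 2b + 1 < f² + 2f + 1 = (f + 1)²: no square fits
-- there. The case e − c = 1 is the same with b and c exchanged.
{-# OPTIONS --safe #-}
module Submission where

open import Defs
open import Data.Nat using (ℕ; _*_; _+_; _<_; zero; suc; s≤s; z≤n)
open import Data.Nat.Primality using (Prime)
open import Data.Nat.Properties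
open import Data.Nat.Tactic.RingSolver using (solve-∀)
open import Data.Integer using (+_; _-_; _⊖_) renaming (_+_ to _+ℤ_)
import Data.Integer.Properties as ℤ
open import Data.Product using (_×_; _,_)
open import Data.Product.Properties using (,-injectiveˡ)
open import Data.Empty using (⊥)
open import Relation.Binary.PropositionalEquality using (_≡_; _≢_; sym; trans; cong; subst; module ≡-Reasoning)
open import Relation.Nullary using (¬_)

m⊖n≡+o⇒m≡o+n : ∀ m n {o} → m ⊖ n ≡ + o → m ≡ o + n
m⊖n≡+o⇒m≡o+n m       zero    eq = trans (ℤ.+-injective eq) (sym (+-identityʳ _))
m⊖n≡+o⇒m≡o+n zero    (suc n) ()
m⊖n≡+o⇒m≡o+n (suc m) (suc n) {o} eq = begin
  suc m        ≡⟨ cong suc (m⊖n≡+o⇒m≡o+n m n (trans (sym (ℤ.[1+m]⊖[1+n]≡m⊖n m n)) eq)) ⟩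
  suc (o + n)  ≡⟨ +-suc o n ⟨
  o + suc n    ∎
  where open ≡-Reasoning

m²<n²⇒m<n : ∀ {m n} → m * m < n * n → m < n
m²<n²⇒m<n m²<n² = ≰⇒> (λ n≤m → <⇒≱ m²<n² (*-mono-≤ n≤m n≤m))

n²≡m²+o²⇒m<n : ∀ {m n o} → 0 < o → n * n ≡ m * m + o * o → m < n
n²≡m²+o²⇒m<n {m} {n} 0<o n²≡m²+o² =
  m²<n²⇒m<n {m} {n} (subst (m * m <_) (sym n²≡m²+o²) (m<m+n (m * m) (*-mono-< 0<o 0<o)))

[1+m]²≡1+2m+m² : ∀ m → suc m * suc m ≡ suc (m + m) + m * m
[1+m]²≡1+2m+m² = solve-∀

no-square-between-consecutive-squares : ∀ {m n} → m * m < n * n → n * n < suc m * suc m → ⊥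
no-square-between-consecutive-squares {m} {n} m²<n² n²<[1+m]² =
  <⇒≱ n²<[1+m]² (*-mono-≤ m<n m<n)
  where
  m<n : m < n
  m<n = m²<n²⇒m<n m²<n²

[1+b]²≡a²+b²⇒a²+f²≢g² : ∀ {a b f g} → suc b * suc b ≡ a * a + b * b → b < f →
  g * g ≢ a * a + f * f
[1+b]²≡a²+b²⇒a²+f²≢g² {a} {b} {f} {g} [1+b]²≡a²+b² b<f g²≡a²+f² =
  no-square-between-consecutive-squares {f} {g} f²<g² g²<[1+f]²
  where
  open ≤-Reasoning
  a²≡1+2b : a * a ≡ suc (b + b)
  a²≡1+2b = +-cancelʳ-≡ (b * b) _ _ (trans (sym [1+b]²≡a²+b²) ([1+m]²≡1+2m+m² b))
  g²≡1+2b+f² : g * g ≡ suc (b + b) + f * f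
  g²≡1+2b+f² = trans g²≡a²+f² (cong (_+ f * f) a²≡1+2b)
  f²<g² : f * f < g * g
  f²<g² = subst (f * f <_) (sym g²≡1+2b+f²) (m<n+m (f * f) (s≤s z≤n))
  g²<[1+f]² : g * g < suc f * suc f
  g²<[1+f]² = begin-strict
    g * g                ≡⟨ g²≡1+2b+f² ⟩
    suc (b + b) + f * f  <⟨ +-monoˡ-< (f * f) (s≤s (+-mono-< b<f b<f)) ⟩
    suc (f + f) + f * f  ≡⟨ [1+m]²≡1+2m+m² f ⟨
    suc f * suc f        ∎

lemma3 : (a b c d e f g p q : ℕ) →
    0 < a → 0 < b → 0 < c → 0 < d → 0 < e → 0 < f → 0 < g →
    d * d ≡ a * a + b * b → e * e ≡ a * a + c * c → f * f ≡ b * b + c * c →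
    g * g ≡ a * a + b * b + c * c →
    Prime p → Prime q → a ≡ p * q →
    ¬ ((((+ d) - (+ b)) , ((+ d) +ℤ (+ b))) ≡ (+ 1 , + (p * p * (q * q))))
      × ¬ ((((+ e) - (+ c)) , ((+ e) +ℤ (+ c))) ≡ (+ 1 , + (p * p * (q * q))))
lemma3 a b c d e f g p q _ 0<b 0<c _ _ _ _ d²≡a²+b² e²≡a²+c² f²≡b²+c² g²≡a²+b²+c² _ _ _ =
  (λ eq → x-y≢1 d b d²≡a²+b² b<f (,-injectiveˡ eq)) ,
  (λ eq → x-y≢1 e c e²≡a²+c² c<f (,-injectiveˡ eq))
  where
  open ≡-Reasoning
  b<f : b < f
  b<f = n²≡m²+o²⇒m<n {b} {f} {c} 0<c f²≡b²+c²
  c<f : c < f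
  c<f = n²≡m²+o²⇒m<n {c} {f} {b} 0<b (trans f²≡b²+c² (+-comm (b * b) (c * c)))
  g²≡a²+f² : g * g ≡ a * a + f * f
  g²≡a²+f² = begin
    g * g                   ≡⟨ g²≡a²+b²+c² ⟩
    a * a + b * b + c * c   ≡⟨ +-assoc (a * a) (b * b) (c * c) ⟩
    a * a + (b * b + c * c) ≡⟨ cong (_+_ (a * a)) f²≡b²+c² ⟨
    a * a + f * f           ∎
  x-y≢1 : ∀ x y → x * x ≡ a * a + y * y → y < f → + x - + y ≢ + 1
  x-y≢1 x y x²≡a²+y² y<f x-y≡1 =
    [1+b]²≡a²+b²⇒a²+f²≢g² {a} {y} {f} {g} [1+y]²≡a²+y² y<f g²≡a²+f²
    where
    x≡1+y : x ≡ suc y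
    x≡1+y = m⊖n≡+o⇒m≡o+n x y (trans (sym (ℤ.[+m]-[+n]≡m⊖n x y)) x-y≡1)
    [1+y]²≡a²+y² : suc y * suc y ≡ a * a + y * y
    [1+y]²≡a²+y² = subst (λ z → z * z ≡ a * a + y * y) x≡1+y x²≡a²+y²
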